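{- Let $U$ be an ultrafilter on $\omega$ and $I\subseteq U^*$ an ideal on $\omega$. The following are equivalent: (1) $U$ has the $I$-pseudo intersection property: for every sequence $\langle X_n:n<\omega\rangle\subseteq U$ there is $X\in U$ with $X\setminus X_n\in I$ for all $n$; (2) for every partition $\langle A_n:n<\omega\rangle$ of $\omega$ with $A_n\notin U$ for all $n$, there is $A\in U$ with $A\cap A_n\in I$ for every $n$; (3) every function $f:\omega\to\omega$ which is unbounded modulo $U$ (i.e. $f^{ -1}[\{0,\dots,n\}]\notin U$ for every $n$) is $I$-to-one modulo $U$: there is $A\in U$ such that $f^{ -1}[\{0,\dots,n\}]\cap A\in I$ for every $n<\omega$.
   Context: $U^*=\{\omega\setminus A:A\in U\}$ is the dual ideal of $U$. -}

module Defs where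

open import Data.Nat using (ℕ; _≤ᵇ_)
open import Data.Bool using (Bool; true; false; _∧_; _∨_; not)
open import Data.Product using (Σ; _×_)
open import Data.Empty using (⊥)
open import Relation.Binary.PropositionalEquality using (_≡_)
open import Relation.Nullary using (¬_)
open import Data.Sum using (_⊎_)

Subset : Set
Subset = ℕ → Bool

_∈_ : ℕ → Subset → Set
k ∈ A = A k ≡ true

_∉_ : ℕ → Subset → Set
k ∉ A = ¬ (k ∈ A)

_⊆_ : Subset → Subset → Set
A ⊆ B = ∀ k → k ∈ A → k ∈ B

∅ : Subset
∅ _ = false

ω : Subset
ω _ = true

∁ : Subset → Subset
∁ A k = not (A k)

_∩_ : Subset → Subset → Subset
(A ∩ B) k = A k ∧ B k

_∪_ : Subset → Subset → Subset
(A ∪ B) k = A k ∨ B k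

_∖_ : Subset → Subset → Subset
(A ∖ B) k = A k ∧ not (B k)

preimage≤ : (ℕ → ℕ) → ℕ → Subset
preimage≤ f n k = f k ≤ᵇ n

Family : Set₁
Family = Subset → Set

record IsUltrafilter (U : Family) : Set where
  field
    ω∈U      : U ω
    ∅∉U      : ¬ U ∅
    upward   : ∀ {A B} → A ⊆ B → U A → U B
    ∩-closed : ∀ {A B} → U A → U B → U (A ∩ B)
    ultra    : ∀ A → U A ⊎ U (∁ A)

record IsIdeal (I : Family) : Set where
  field
    ∅∈I      : I ∅
    downward : ∀ {A B} → A ⊆ B → I B → I A
    ∪-closed : ∀ {A B} → I A → I B → I (A ∪ B)

-- I ⊆ U* where U* = {ω ∖ A : A ∈ U}
_⊆Dual_ : Family → Family → Set
I ⊆Dual U = ∀ A → I A → U (∁ A)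

IsPartition : (ℕ → Subset) → Set
IsPartition A = ∀ k → Σ ℕ (λ n → (k ∈ A n) × (∀ m → k ∈ A m → m ≡ n))

PseudoIntersectionProp : Family → Family → Set
PseudoIntersectionProp U I =
  (X : ℕ → Subset) → (∀ n → U (X n)) →
  Σ Subset (λ Y → U Y × (∀ n → I (Y ∖ X n)))

PartitionProp : Family → Family → Set
PartitionProp U I =
  (A : ℕ → Subset) → IsPartition A → (∀ n → ¬ U (A n)) →
  Σ Subset (λ B → U B × (∀ n → I (B ∩ A n)))

UnboundedMod : Family → (ℕ → ℕ) → Set
UnboundedMod U f = ∀ n → ¬ U (preimage≤ f n)

ItoOneMod : Family → Family → (ℕ → ℕ) → Set
ItoOneMod U I f = Σ Subset (λ A → U A × (∀ n → I (preimage≤ f n ∩ A)))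

ItoOneProp : Family → Family → Set
ItoOneProp U I = (f : ℕ → ℕ) → UnboundedMod U f → ItoOneMod U I f

{-# OPTIONS --safe #-}
module Submission where

-- (1) ⇒ (2): apply (1) to the complements of the Aₙ.
-- (2) ⇒ (3): apply (2) to the fibres of f; f⁻¹[{0,…,n}] is the union of the
-- first n + 1 of them, so its intersection with A lies in I.
-- (3) ⇒ (1): if U is principal, its generator works. Otherwise let
-- f k = min(k, least n with k ∉ Xₙ), so that A ∖ Xₙ ⊆ f⁻¹[{0,…,n}] ∩ A.
-- This f is unbounded modulo U: f⁻¹[{0,…,m}] ∩ X₀ ∩ ⋯ ∩ Xₘ ⊆ {0,…,m}, and a
-- non-principal ultrafilter contains no finite set.

open import Defs
open import Data.Bool using (Bool; true; false; T)
open import Data.Bool.Properties using (_≟_; not-involutive; ¬-not; T-≡)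
open import Data.Nat using (ℕ; zero; suc; _≤_; _<_; _≡ᵇ_; z≤n; s≤s)
open import Data.Nat.Properties using (≤ᵇ⇒≤; ≤⇒≤ᵇ; ≡ᵇ⇒≡; ≡⇒≡ᵇ; ≤-refl; n≤0⇒n≡0; m≤n⇒m<n∨m≡n; ≤∧≢⇒<)
open import Data.Product using (Σ; _×_; _,_)
open import Data.Sum using (_⊎_; inj₁; inj₂; [_,_])
open import Function.Bundles using (Equivalence)
open import Relation.Binary.PropositionalEquality using (_≡_; refl; sym; trans; subst)
open import Relation.Nullary using (¬_; Dec; yes; no; contradiction)
open import Relation.Nullary.Decidable using (isYes; toWitness; fromWitness)

T⇒≡true : ∀ {b} → T b → b ≡ true
T⇒≡true = Equivalence.to T-≡

≡true⇒T : ∀ {b} → b ≡ true → T b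
≡true⇒T = Equivalence.from T-≡

∩-⊆ˡ : ∀ A B → (A ∩ B) ⊆ A
∩-⊆ˡ A B k p with A k
... | true = refl

∩-⊆ʳ : ∀ A B → (A ∩ B) ⊆ B
∩-⊆ʳ A B k p with A k
... | true = p

∈-∩ : ∀ A B k → k ∈ A → k ∈ B → k ∈ (A ∩ B)
∈-∩ A B k p q rewrite p | q = refl

∈-∪ˡ : ∀ A B k → k ∈ A → k ∈ (A ∪ B)
∈-∪ˡ A B k p rewrite p = refl

∈-∪ʳ : ∀ A B k → k ∈ B → k ∈ (A ∪ B)
∈-∪ʳ A B k p with A k
... | true  = refl
... | false = p

∈-∁⇒∉ : ∀ A k → k ∈ ∁ A → k ∉ A
∈-∁⇒∉ A k p q rewrite q = contradiction p λ ()

∈-∖⇒∉ : ∀ A B k → k ∈ (A ∖ B) → k ∉ B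
∈-∖⇒∉ A B k p = ∈-∁⇒∉ B k (∩-⊆ʳ A (∁ B) k p)

∩⊆∖∁ : ∀ A B → (A ∩ B) ⊆ (A ∖ ∁ B)
∩⊆∖∁ A B k p rewrite not-involutive (B k) = p

∈-preimage≤ : ∀ f {n} k → f k ≤ n → k ∈ preimage≤ f n
∈-preimage≤ f k p = T⇒≡true (≤⇒≤ᵇ p)

∈-preimage≤⇒≤ : ∀ f n k → k ∈ preimage≤ f n → f k ≤ n
∈-preimage≤⇒≤ f n k p = ≤ᵇ⇒≤ (f k) n (≡true⇒T p)

single : ℕ → Subset
single n k = k ≡ᵇ n

∈-single : ∀ {n} k → k ≡ n → k ∈ single n
∈-single {n} k p = T⇒≡true (≡⇒≡ᵇ k n p)

∈-single⇒≡ : ∀ n k → k ∈ single n → k ≡ n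
∈-single⇒≡ n k p = ≡ᵇ⇒≡ k n (≡true⇒T p)

fibre : (ℕ → ℕ) → ℕ → Subset
fibre f n k = single n (f k)

fibre-partition : ∀ f → IsPartition (fibre f)
fibre-partition f k = f k , ∈-single (f k) refl , λ m p → sym (∈-single⇒≡ m (f k) p)

fibre⊆preimage≤ : ∀ f n → fibre f n ⊆ preimage≤ f n
fibre⊆preimage≤ f n k p = ∈-preimage≤ f k (subst (_≤ n) (sym (∈-single⇒≡ n (f k) p)) ≤-refl)

preimage≤-zero : ∀ f → preimage≤ f 0 ⊆ fibre f 0
preimage≤-zero f k p = ∈-single (f k) (n≤0⇒n≡0 (∈-preimage≤⇒≤ f 0 k p))

preimage≤-suc : ∀ f n k → k ∈ preimage≤ f (suc n) → k ∈ preimage≤ f n ⊎ k ∈ fibre f (suc n)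
preimage≤-suc f n k p with m≤n⇒m<n∨m≡n (∈-preimage≤⇒≤ f (suc n) k p)
... | inj₁ (s≤s fk≤n) = inj₁ (∈-preimage≤ f k fk≤n)
... | inj₂ fk≡sn     = inj₂ (∈-single (f k) fk≡sn)

⋂≤ : (ℕ → Subset) → ℕ → Subset
⋂≤ X zero    = X zero
⋂≤ X (suc m) = ⋂≤ X m ∩ X (suc m)

⋂≤-⊆ : ∀ X {i} m → i ≤ m → ⋂≤ X m ⊆ X i
⋂≤-⊆ X zero    z≤n k p = p
⋂≤-⊆ X (suc m) i≤sm k p with m≤n⇒m<n∨m≡n i≤sm
... | inj₁ (s≤s i≤m) = ⋂≤-⊆ X m i≤m k (∩-⊆ˡ (⋂≤ X m) (X (suc m)) k p)
... | inj₂ refl      = ∩-⊆ʳ (⋂≤ X m) (X (suc m)) k p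

leadingTrues : (ℕ → Bool) → ℕ → ℕ
leadingTrues p zero    = 0
leadingTrues p (suc b) with p 0
... | true  = suc (leadingTrues (λ i → p (suc i)) b)
... | false = 0

leadingTrues-≤ : ∀ p b {n} → p n ≡ false → leadingTrues p b ≤ n
leadingTrues-≤ p zero    pn≡false = z≤n
leadingTrues-≤ p (suc b) {n} pn≡false with p 0 in p0
... | false = z≤n
... | true with n
...   | zero  = contradiction (trans (sym p0) pn≡false) λ ()
...   | suc n′ = s≤s (leadingTrues-≤ (λ i → p (suc i)) b pn≡false)

leadingTrues-≤⇒≤ : ∀ p b {m} → (∀ i → i ≤ m → p i ≡ true) → leadingTrues p b ≤ m → b ≤ m
leadingTrues-≤⇒≤ p zero    all-true q = z≤n
leadingTrues-≤⇒≤ p (suc b) all-true q with p 0 | all-true 0 z≤n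
... | .true | refl with q
...   | s≤s q′ = s≤s (leadingTrues-≤⇒≤ (λ i → p (suc i)) b (λ i i≤m → all-true (suc i) (s≤s i≤m)) q′)

-- depth X k = min(k, least n with k ∉ Xₙ); the cap k keeps it total when k lies in every Xₙ.
depth : (ℕ → Subset) → ℕ → ℕ
depth X k = leadingTrues (λ n → X n k) k

depth-≤ : ∀ X {n} k → k ∉ X n → depth X k ≤ n
depth-≤ X k k∉Xn = leadingTrues-≤ (λ n → X n k) k (¬-not k∉Xn)

depth-≤⇒≤ : ∀ X m k → k ∈ ⋂≤ X m → depth X k ≤ m → k ≤ m
depth-≤⇒≤ X m k k∈⋂ = leadingTrues-≤⇒≤ (λ n → X n k) k (λ i i≤m → ⋂≤-⊆ X m i≤m k k∈⋂)

∖⊆preimage≤-depth : ∀ X A n → (A ∖ X n) ⊆ (preimage≤ (depth X) n ∩ A)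
∖⊆preimage≤-depth X A n k p =
  ∈-∩ (preimage≤ (depth X) n) A k
      (∈-preimage≤ (depth X) k (depth-≤ X k (∈-∖⇒∉ A (X n) k p)))
      (∩-⊆ˡ A (∁ (X n)) k p)

module _ {U : Family} (uf : IsUltrafilter U) where
  open IsUltrafilter uf

  U-nonempty : ∀ {A} → U A → ¬ (∀ k → k ∉ A)
  U-nonempty uA empty = ∅∉U (upward (λ k p → contradiction p (empty k)) uA)

  ∁-∉U : ∀ {A} → U A → ¬ U (∁ A)
  ∁-∉U {A} uA u∁A = U-nonempty (∩-closed uA u∁A) λ k p →
    ∈-∁⇒∉ A k (∩-⊆ʳ A (∁ A) k p) (∩-⊆ˡ A (∁ A) k p)

  ∁-∈U : ∀ {A} → ¬ U A → U (∁ A)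
  ∁-∈U {A} ¬uA with ultra A
  ... | inj₁ uA  = contradiction uA ¬uA
  ... | inj₂ u∁A = u∁A

  U? : ∀ A → Dec (U A)
  U? A with ultra A
  ... | inj₁ uA  = yes uA
  ... | inj₂ u∁A = no λ uA → ∁-∉U uA u∁A

  ⋂≤-∈U : ∀ X → (∀ n → U (X n)) → ∀ m → U (⋂≤ X m)
  ⋂≤-∈U X uX zero    = uX zero
  ⋂≤-∈U X uX (suc m) = ∩-closed (⋂≤-∈U X uX m) (uX (suc m))

  single-∈U⇒∈ : ∀ {a A} → U (single a) → U A → a ∈ A
  single-∈U⇒∈ {a} {A} ua uA with A a ≟ true
  ... | yes a∈A = a∈A
  ... | no  a∉A = contradiction (∩-closed ua uA) λ u → U-nonempty u λ k p →
    a∉A (subst (_∈ A) (∈-single⇒≡ a k (∩-⊆ˡ (single a) A k p)) (∩-⊆ʳ (single a) A k p))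

  bounded⇒single-∈U : ∀ m {W} → U W → (∀ k → k ∈ W → k < m) →
                      Σ ℕ λ a → a ∈ W × U (single a)
  bounded⇒single-∈U zero    uW bounded =
    contradiction uW λ u → U-nonempty u λ k p → contradiction (bounded k p) λ ()
  bounded⇒single-∈U (suc m) {W} uW bounded with ultra (single m)
  ... | inj₁ um = m , single-∈U⇒∈ um uW , um
  ... | inj₂ u∁m with bounded⇒single-∈U m (∩-closed uW u∁m) below-m
    where
      below-m : ∀ k → k ∈ (W ∩ ∁ (single m)) → k < m
      below-m k p with bounded k (∩-⊆ˡ W (∁ (single m)) k p)
      ... | s≤s k≤m = ≤∧≢⇒< k≤m λ k≡m → ∈-∁⇒∉ (single m) k (∩-⊆ʳ W (∁ (single m)) k p) (∈-single k k≡m)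
  ... | a , a∈W∖m , ua = a , ∩-⊆ˡ W (∁ (single m)) a a∈W∖m , ua

  atoms : Subset
  atoms a = isYes (U? (single a))

  ∈-atoms⇒ : ∀ a → a ∈ atoms → U (single a)
  ∈-atoms⇒ a p = toWitness (≡true⇒T p)

  atoms-⊆ : ∀ {A} → U A → atoms ⊆ A
  atoms-⊆ uA a p = single-∈U⇒∈ (∈-atoms⇒ a p) uA

  ∁atoms∈U⇒bounded∉U : U (∁ atoms) → ∀ m {W} → U W → ¬ (∀ k → k ∈ W → k < m)
  ∁atoms∈U⇒bounded∉U u∁atoms m {W} uW bounded
    with bounded⇒single-∈U m (∩-closed uW u∁atoms) (λ k p → bounded k (∩-⊆ˡ W (∁ atoms) k p))
  ... | a , a∈W∖atoms , ua =
    ∈-∁⇒∉ atoms a (∩-⊆ʳ W (∁ atoms) a a∈W∖atoms) (T⇒≡true (fromWitness ua))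

  depth-unboundedMod : U (∁ atoms) → ∀ X → (∀ n → U (X n)) → UnboundedMod U (depth X)
  depth-unboundedMod u∁atoms X uX m u =
    ∁atoms∈U⇒bounded∉U u∁atoms (suc m) (∩-closed u (⋂≤-∈U X uX m)) λ k p →
      s≤s (depth-≤⇒≤ X m k (∩-⊆ʳ (preimage≤ (depth X) m) (⋂≤ X m) k p)
                           (∈-preimage≤⇒≤ (depth X) m k (∩-⊆ˡ (preimage≤ (depth X) m) (⋂≤ X m) k p)))

module _ {I : Family} (ideal : IsIdeal I) where
  open IsIdeal ideal

  preimage≤∩-∈I : ∀ f B → (∀ n → I (B ∩ fibre f n)) → ∀ n → I (preimage≤ f n ∩ B)
  preimage≤∩-∈I f B fibres∈I zero = downward sub (fibres∈I 0)
    where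
      sub : (preimage≤ f 0 ∩ B) ⊆ (B ∩ fibre f 0)
      sub k p = ∈-∩ B (fibre f 0) k (∩-⊆ʳ (preimage≤ f 0) B k p)
                                    (preimage≤-zero f k (∩-⊆ˡ (preimage≤ f 0) B k p))
  preimage≤∩-∈I f B fibres∈I (suc n) =
    downward sub (∪-closed (preimage≤∩-∈I f B fibres∈I n) (fibres∈I (suc n)))
    where
      sub : (preimage≤ f (suc n) ∩ B) ⊆ ((preimage≤ f n ∩ B) ∪ (B ∩ fibre f (suc n)))
      sub k p = [ (λ k∈≤n → ∈-∪ˡ (preimage≤ f n ∩ B) (B ∩ fibre f (suc n)) k
                                 (∈-∩ (preimage≤ f n) B k k∈≤n k∈B))
                , (λ k∈fibre → ∈-∪ʳ (preimage≤ f n ∩ B) (B ∩ fibre f (suc n)) k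
                                    (∈-∩ B (fibre f (suc n)) k k∈B k∈fibre))
                ] (preimage≤-suc f n k (∩-⊆ˡ (preimage≤ f (suc n)) B k p))
        where
          k∈B : k ∈ B
          k∈B = ∩-⊆ʳ (preimage≤ f (suc n)) B k p

module _ {U I : Family} (uf : IsUltrafilter U) (ideal : IsIdeal I) where
  open IsUltrafilter uf
  open IsIdeal ideal

  pseudoIntersection⇒partition : PseudoIntersectionProp U I → PartitionProp U I
  pseudoIntersection⇒partition pip A _ A∉U with pip (λ n → ∁ (A n)) (λ n → ∁-∈U uf (A∉U n))
  ... | Y , uY , differences∈I = Y , uY , λ n → downward (∩⊆∖∁ Y (A n)) (differences∈I n)

  partition⇒ItoOne : PartitionProp U I → ItoOneProp U I
  partition⇒ItoOne pp f unbounded with pp (fibre f) (fibre-partition f) fibres∉U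
    where
      fibres∉U : ∀ n → ¬ U (fibre f n)
      fibres∉U n u = unbounded n (upward (fibre⊆preimage≤ f n) u)
  ... | B , uB , fibres∈I = B , uB , preimage≤∩-∈I ideal f B fibres∈I

  ItoOne⇒pseudoIntersection : ItoOneProp U I → PseudoIntersectionProp U I
  ItoOne⇒pseudoIntersection ito X uX with ultra (atoms uf)
  ... | inj₁ uatoms = atoms uf , uatoms , λ n → downward (atoms∖X⊆∅ n) ∅∈I
    where
      atoms∖X⊆∅ : ∀ n → (atoms uf ∖ X n) ⊆ ∅
      atoms∖X⊆∅ n k p = contradiction (atoms-⊆ uf (uX n) k (∩-⊆ˡ (atoms uf) (∁ (X n)) k p))
                                      (∈-∖⇒∉ (atoms uf) (X n) k p)
  ... | inj₂ u∁atoms with ito (depth X) (depth-unboundedMod uf u∁atoms X uX)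
  ...   | A , uA , preimages∈I = A , uA , λ n → downward (∖⊆preimage≤-depth X A n) (preimages∈I n)

-- The equivalences hold for every ideal I.
proposition3p7 : (U I : Family) → IsUltrafilter U → IsIdeal I → I ⊆Dual U →
    (PseudoIntersectionProp U I → PartitionProp U I)
    × (PartitionProp U I → ItoOneProp U I)
    × (ItoOneProp U I → PseudoIntersectionProp U I)
proposition3p7 U I uf ideal _ =
  pseudoIntersection⇒partition uf ideal , partition⇒ItoOne uf ideal , ItoOne⇒pseudoIntersection uf ideal
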